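{- Let $D,E$ be as defined in the context and let $Y$ be any word in the letters $D,E$, of length $|Y|$, viewed as a matrix product. Then for all integers $i\ge1$ and $j,k,\ell\ge0$, $$Y_{i,j,k,\ell}=q^{|Y|}\,Y_{i-1,j-1,k,\ell}.$$
   Context: Parameters $\alpha,\beta,\gamma,\delta,q$. For nonnegative integers $i,j,k,\ell$ define $D_{i,j,k,\ell}$ and $E_{i,j,k,\ell}$ recursively (any entry with a negative index is $0$): $D_{i,j,k,\ell}=0$ if $j<i$ or $\ell>k+1$; $=\delta q^i$ if $j=i+1$, $k=\ell=0$; $=\alpha q^i$ if $j=i$, $k=0$, $\ell=1$; otherwise $D_{i,j,k,\ell}=\delta(D_{i,j-1,k-1,\ell}+E_{i,j-1,k-1,\ell})+D_{i,j,k-1,\ell-1}$. $E_{i,j,k,\ell}=0$ if $j<i$ or $\ell>k+1$; $=\beta q^i$ if $j=i$, $k=\ell=0$; $=\gamma q^i$ if $j=i$, $k=0$, $\ell=1$; otherwise $E_{i,j,k,\ell}=\beta(D_{i,j,k-1,\ell}+E_{i,j,k-1,\ell})+qE_{i,j,k-1,\ell-1}$. Matrix products: $(MN)_{i,j,k,\ell}=\sum_{a,b}M_{i,a,k,b}N_{a,j,b,\ell}$; entries with a negative index are $0$. -}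

module Defs where

open import Level using (Level)
open import Algebra.Bundles using (CommutativeRing)
open import Data.Nat as ℕ using (ℕ; zero; suc; _<ᵇ_; _≡ᵇ_)
open import Data.Integer as ℤ using (ℤ; +_; -[1+_])
open import Data.Bool using (Bool; true; false; if_then_else_; _∨_; _∧_)
open import Data.List using (List; []; _∷_; length)

data Letter : Set where
  𝐃 𝐄 : Letter

module _ {c ℓ : Level} (R : CommutativeRing c ℓ) where
  open CommutativeRing R

  pow : Carrier → ℕ → Carrier
  pow x zero    = 1#
  pow x (suc n) = x * pow x n

  Matrix : Set c
  Matrix = ℕ → ℕ → ℕ → ℕ → Carrier

  entry : Matrix → ℤ → ℤ → ℤ → ℤ → Carrier
  entry M (+ i) (+ j) (+ k) (+ l) = M i j k l
  entry M _ _ _ _ = 0#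

  sumTo : ℕ → (ℕ → Carrier) → Carrier
  sumTo zero    f = f 0
  sumTo (suc n) f = sumTo n f + f (suc n)

  module Params (α β γ δ q : Carrier) where

    -- D and E, by mutual recursion on k.  Entries with a negative index
    -- (j-1 with j = 0, k-1 with k = 0, ℓ-1 with ℓ = 0) are read as 0.
    D E : Matrix
    D i j zero l =
      if (j <ᵇ i) ∨ (1 <ᵇ l) then 0#
      else if (j ≡ᵇ suc i) ∧ (l ≡ᵇ 0) then δ * pow q i
      else if (j ≡ᵇ i) ∧ (l ≡ᵇ 1) then α * pow q i
      else 0#   -- "otherwise" case: all recursive terms have index k-1 = -1
    D i j (suc k) l =
      if (j <ᵇ i) ∨ (suc (suc k) <ᵇ l) then 0#
      else δ * (Dm j + Em j) + Dl l
      where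
        Dm Em : ℕ → Carrier
        Dm zero    = 0#
        Dm (suc j') = D i j' k l
        Em zero    = 0#
        Em (suc j') = E i j' k l
        Dl : ℕ → Carrier
        Dl zero     = 0#
        Dl (suc l') = D i j k l'
    E i j zero l =
      if (j <ᵇ i) ∨ (1 <ᵇ l) then 0#
      else if (j ≡ᵇ i) ∧ (l ≡ᵇ 0) then β * pow q i
      else if (j ≡ᵇ i) ∧ (l ≡ᵇ 1) then γ * pow q i
      else 0#
    E i j (suc k) l =
      if (j <ᵇ i) ∨ (suc (suc k) <ᵇ l) then 0#
      else β * (D i j k l + E i j k l) + q * El l
      where
        El : ℕ → Carrier
        El zero     = 0#
        El (suc l') = E i j k l'

    letter : Letter → Matrix
    letter 𝐃 = D
    letter 𝐄 = E

    I : Matrix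
    I i j k l = if (i ≡ᵇ j) ∧ (k ≡ᵇ l) then 1# else 0#

    -- The sum is over 0 ≤ a ≤ j and 0 ≤ b ≤ k+1; all other terms vanish
    -- (N_{a,j,..} = 0 for a > j, and L_{i,a,k,b} = 0 for b > k+1 by definition).
    mulLetter : Matrix → Matrix → Matrix
    mulLetter L N i j k l =
      sumTo j (λ a → sumTo (suc k) (λ b → L i a k b * N a j b l))

    word : List Letter → Matrix
    word []      = I
    word (x ∷ w) = mulLetter (letter x) (word w)

module Submission where

-- Call a 4-index matrix M "shift-covariant with factor s" if
-- shifting the first two indices down by one rescales it by s:
--   M_{i+1,0,k,ℓ} = 0   and   M_{i+1,j+1,k,ℓ} = s · M_{i,j,k,ℓ}.
-- The theorem says exactly that the word Y is shift-covariant with factor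
-- q^|Y| (the column j = 0 corresponds to the index j-1 = -1, read as 0).

open import Defs
open import Level using (_⊔_)
open import Algebra.Bundles using (CommutativeRing)
open import Data.Nat using (ℕ; suc; zero; _<ᵇ_; _≡ᵇ_)
open import Data.Integer as ℤ using (+_)
open import Data.List using (List; length; []; _∷_)
open import Data.Bool using (true; false; if_then_else_; _∨_; _∧_)
import Algebra.Properties.CommutativeSemigroup as CommutativeSemigroupProperties
import Relation.Binary.Reasoning.Setoid as SetoidReasoning

module ShiftCovariance {c ℓ} (R : CommutativeRing c ℓ) where
  open CommutativeRing R hiding (zero)
  open CommutativeSemigroupProperties *-commutativeSemigroup
    using (x∙yz≈y∙xz; interchange)
  open SetoidReasoning setoid

  sumTo-cong : ∀ n {f g : ℕ → Carrier} → (∀ a → f a ≈ g a) →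
               sumTo R n f ≈ sumTo R n g
  sumTo-cong zero    f≈g = f≈g 0
  sumTo-cong (suc n) f≈g = +-cong (sumTo-cong n f≈g) (f≈g (suc n))

  sumTo-zero : ∀ n {f : ℕ → Carrier} → (∀ a → f a ≈ 0#) → sumTo R n f ≈ 0#
  sumTo-zero zero    f≈0 = f≈0 0
  sumTo-zero (suc n) f≈0 =
    trans (+-cong (sumTo-zero n f≈0) (f≈0 (suc n))) (+-identityˡ 0#)

  sumTo-scale : ∀ n s (f : ℕ → Carrier) →
                s * sumTo R n f ≈ sumTo R n (λ a → s * f a)
  sumTo-scale zero    s f = refl
  sumTo-scale (suc n) s f = trans (distribˡ s _ _) (+-congʳ (sumTo-scale n s f))

  sumTo-peel : ∀ n (f : ℕ → Carrier) →
               sumTo R (suc n) f ≈ f 0 + sumTo R n (λ a → f (suc a))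
  sumTo-peel zero    f = refl
  sumTo-peel (suc n) f = trans (+-congʳ (sumTo-peel n f)) (+-assoc _ _ _)

  record ShiftCovariant (s : Carrier) (M : Matrix R) : Set (c ⊔ ℓ) where
    field
      column-zero : ∀ i k l → M (suc i) 0 k l ≈ 0#
      shift       : ∀ i j k l → M (suc i) (suc j) k l ≈ s * M i j k l
  open ShiftCovariant

  module _ (α β γ δ q : Carrier) where
    open Params R α β γ δ q

    identity-covariant : ShiftCovariant 1# I
    identity-covariant = record
      { column-zero = λ i k l → refl
      ; shift       = λ i j k l → sym (*-identityˡ _)
      }

    -- Covariance is multiplicative.  In (L·N)_{i+1,j+1,k,ℓ} the a = 0 term
    -- vanishes since L_{i+1,0,..} = 0, and the term for a+1 is s·t times the
    -- term for a in (L·N)_{i,j,k,ℓ}.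
    product-covariant : ∀ {s t L N} → ShiftCovariant s L → ShiftCovariant t N →
                        ShiftCovariant (s * t) (mulLetter L N)
    product-covariant {s} {t} {L} {N} covL covN = record
      { column-zero = λ i k l → row-zero-term i 0 k l
      ; shift       = shift-product
      }
      where
        row-zero-term : ∀ i j k l →
          sumTo R (suc k) (λ b → L (suc i) 0 k b * N 0 j b l) ≈ 0#
        row-zero-term i j k l = sumTo-zero (suc k) λ b →
          trans (*-congʳ (column-zero covL i k b)) (zeroˡ _)

        shift-product : ∀ i j k l →
          mulLetter L N (suc i) (suc j) k l ≈ (s * t) * mulLetter L N i j k l
        shift-product i j k l = begin
          sumTo R (suc j) F                          ≈⟨ sumTo-peel j F ⟩
          F 0 + sumTo R j (λ a → F (suc a))          ≈⟨ +-cong (row-zero-term i (suc j) k l)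
                                                                (sumTo-cong j shifted-term) ⟩
          0# + sumTo R j (λ a → (s * t) * G a)       ≈⟨ +-identityˡ _ ⟩
          sumTo R j (λ a → (s * t) * G a)            ≈⟨ sumTo-scale j (s * t) G ⟨
          (s * t) * sumTo R j G                      ∎
          where
            F G : ℕ → Carrier
            F a = sumTo R (suc k) (λ b → L (suc i) a k b * N a (suc j) b l)
            G a = sumTo R (suc k) (λ b → L i a k b * N a j b l)

            shifted-term : ∀ a → F (suc a) ≈ (s * t) * G a
            shifted-term a =
              trans (sumTo-cong (suc k) λ b →
                       trans (*-cong (shift covL i a k b) (shift covN a j b l))
                             (interchange s _ t _))
                    (sym (sumTo-scale (suc k) (s * t) _))

    -- Each defining clause of D and E is preserved under multiplication by q,
    -- branch by branch; these three facts cover all the shapes that occur.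

    zero-scaled : ∀ {x} → x ≈ 0# → x ≈ q * 0#
    zero-scaled x≈0 = trans x≈0 (sym (zeroʳ q))

    if-scaled : ∀ b {X Y X′ Y′} → X ≈ q * X′ → Y ≈ q * Y′ →
                (if b then X else Y) ≈ q * (if b then X′ else Y′)
    if-scaled true  X≈ Y≈ = X≈
    if-scaled false X≈ Y≈ = Y≈

    recurrence-scaled : ∀ x {A B C A′ B′ C′} →
      A ≈ q * A′ → B ≈ q * B′ → C ≈ q * C′ →
      x * (A + B) + C ≈ q * (x * (A′ + B′) + C′)
    recurrence-scaled x {A} {B} {C} {A′} {B′} {C′} A≈ B≈ C≈ = begin
      x * (A + B) + C                ≈⟨ +-cong (*-congˡ (trans (+-cong A≈ B≈) (sym (distribˡ q A′ B′)))) C≈ ⟩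
      x * (q * (A′ + B′)) + q * C′   ≈⟨ +-congʳ (x∙yz≈y∙xz x q (A′ + B′)) ⟩
      q * (x * (A′ + B′)) + q * C′   ≈⟨ distribˡ q _ _ ⟨
      q * (x * (A′ + B′) + C′)       ∎

    weight-scaled : ∀ x n → x * pow R q (suc n) ≈ q * (x * pow R q n)
    weight-scaled x n = x∙yz≈y∙xz x q (pow R q n)

    -- Row i+1 of D and E vanishes in column 0 (the guard j < i fires).
    column-zero-D : ∀ i k l → D (suc i) 0 k l ≈ 0#
    column-zero-D i zero    l = refl
    column-zero-D i (suc k) l = refl

    column-zero-E : ∀ i k l → E (suc i) 0 k l ≈ 0#
    column-zero-E i zero    l = refl
    column-zero-E i (suc k) l = refl

    -- The
    -- guards of row i+1, column j+1 coincide with those of row i, column j;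
    -- the recursive terms read the neighbours at indices j-1 and l-1, which
    -- are either covered by the induction hypothesis or are 0 on both sides.
    shift-D : ∀ i j k l → D (suc i) (suc j) k l ≈ q * D i j k l
    shift-E : ∀ i j k l → E (suc i) (suc j) k l ≈ q * E i j k l

    shift-D i j zero l =
      if-scaled ((j <ᵇ i) ∨ (1 <ᵇ l)) (zero-scaled refl)
        (if-scaled ((j ≡ᵇ suc i) ∧ (l ≡ᵇ 0)) (weight-scaled δ i)
          (if-scaled ((j ≡ᵇ i) ∧ (l ≡ᵇ 1)) (weight-scaled α i) (zero-scaled refl)))
    shift-D i zero (suc k) zero =
      if-scaled _ (zero-scaled refl)
        (recurrence-scaled δ (zero-scaled (column-zero-D i k 0))
                             (zero-scaled (column-zero-E i k 0)) (zero-scaled refl))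
    shift-D i zero (suc k) (suc l) =
      if-scaled _ (zero-scaled refl)
        (recurrence-scaled δ (zero-scaled (column-zero-D i k (suc l)))
                             (zero-scaled (column-zero-E i k (suc l))) (shift-D i zero k l))
    shift-D i (suc j) (suc k) zero =
      if-scaled _ (zero-scaled refl)
        (recurrence-scaled δ (shift-D i j k 0) (shift-E i j k 0) (zero-scaled refl))
    shift-D i (suc j) (suc k) (suc l) =
      if-scaled _ (zero-scaled refl)
        (recurrence-scaled δ (shift-D i j k (suc l)) (shift-E i j k (suc l))
                             (shift-D i (suc j) k l))

    shift-E i j zero l =
      if-scaled ((j <ᵇ i) ∨ (1 <ᵇ l)) (zero-scaled refl)
        (if-scaled ((j ≡ᵇ i) ∧ (l ≡ᵇ 0)) (weight-scaled β i)
          (if-scaled ((j ≡ᵇ i) ∧ (l ≡ᵇ 1)) (weight-scaled γ i) (zero-scaled refl)))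
    shift-E i j (suc k) zero =
      if-scaled _ (zero-scaled refl)
        (recurrence-scaled β (shift-D i j k 0) (shift-E i j k 0)
                             (*-congˡ (zero-scaled refl)))
    shift-E i j (suc k) (suc l) =
      if-scaled _ (zero-scaled refl)
        (recurrence-scaled β (shift-D i j k (suc l)) (shift-E i j k (suc l))
                             (*-congˡ (shift-E i j k l)))

    letter-covariant : ∀ x → ShiftCovariant q (letter x)
    letter-covariant 𝐃 = record { column-zero = column-zero-D ; shift = shift-D }
    letter-covariant 𝐄 = record { column-zero = column-zero-E ; shift = shift-E }

    word-covariant : ∀ Y → ShiftCovariant (pow R q (length Y)) (word Y)
    word-covariant []      = identity-covariant
    word-covariant (x ∷ Y) = product-covariant (letter-covariant x) (word-covariant Y)

open ShiftCovariance using (ShiftCovariant; word-covariant)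

-- The theorem is the shift-covariance of Y read off entrywise: for column
-- j+1 it is the shift law, and column 0 (index j-1 = -1, right side 0) is the
-- vanishing first column.
lemma6p7 : ∀ {c ℓ} (R : CommutativeRing c ℓ) →
    let open CommutativeRing R in
    (α β γ δ q : Carrier) (Y : List Letter) (i j k l : ℕ) →
    let open Params R α β γ δ q in
    word Y (suc i) j k l
    ≈ pow R q (length Y) * entry R (word Y) (+ i) (+ j ℤ.- + 1) (+ k) (+ l)
lemma6p7 R α β γ δ q Y i zero k l =
  trans (ShiftCovariant.column-zero covariant i k l) (sym (zeroʳ _))
  where
    open CommutativeRing R using (trans; sym; zeroʳ)
    covariant : ShiftCovariant R (pow R q (length Y)) (Params.word R α β γ δ q Y)
    covariant = word-covariant R α β γ δ q Y
lemma6p7 R α β γ δ q Y i (suc j) k l =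
  ShiftCovariant.shift (word-covariant R α β γ δ q Y) i j k l
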